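{- For every $m\ge2$, the component $U_m$ is weighted aperiodic. For every $m\ge3$, the component $V_m$ is weighted aperiodic.
   Context: Let $\operatorname{Av}_j(132)$ be the set of permutations of length $j$ with no indices $i<j'<k$ such that $\pi_i<\pi_k<\pi_{j'}$. Fix $m\ge2$, $B_m=\{0,1,\ldots,m-1,\infty\}$, convention $\infty-r=\infty$. Set $c_{1,p}=1$ and, for $2\le k\le m$, $c_{k,p}=|\{\sigma\in\operatorname{Av}_{k-1}(132):k-\sigma_1\le p\}|$ (no condition if $p=\infty$). $W_m(x)$ is the matrix indexed by $B_m^2$ with $W_{(p,q),(r,s)}(x)=\sum_{k=1}^m c_{k,p}x^k\chi_{(r,s)=(m-k,q-k)}+x\chi_{(r,s)=(p-1,m-1)}$, indicators $0$ when the pair has a negative coordinate. Let $U_m=\{(p,\infty):0\le p\le m-1\}$ and $V_m=\{(p,q):0\le p,q\le m-1,\ q<p\}\cup\{(p,m-1):0\le p\le m-2\}$ (these are strongly connected components of the directed graph on $B_m^2$ with an edge $(r,s)\to(p,q)$ iff $W_{(p,q),(r,s)}\ne0$). For such a component $C$, its weighted dependency graph is the directed multigraph on $C$ with an edge $c\to d$ of weight $j$ for each $j$ such that the coefficient of $x^j$ in $W_{d,c}(x)$ ($c,d\in C$) is positive. The total weight of a closed walk is the sum of its edge weights; the weighted period of $C$ is the gcd of the total weights of all directed closed walks in this multigraph, and $C$ is weighted aperiodic if its weighted period is $1$. -}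

module Defs where

open import Data.Nat using (ℕ; zero; suc; _∸_; _≤_; _<_; _+_; _≤ᵇ_; _≡ᵇ_)
open import Data.Nat.Divisibility using (_∣_)
open import Data.Integer as ℤ using (ℤ; +_)
open import Data.Fin as Fin using (Fin; toℕ)
open import Data.Vec using (Vec; []; _∷_; lookup; head)
open import Data.List using (List; []; _∷_; map; concatMap; allFin; filter; length)
open import Data.Bool using (Bool; true; false; _∧_; _∨_; not; if_then_else_; T)
open import Data.Product using (_×_; _,_; Σ; ∃)
open import Relation.Nullary.Decidable using (⌊_⌋)
open import Relation.Binary.PropositionalEquality using (_≡_)
open import Relation.Nullary using (Dec; yes; no; ¬_)
open import Data.Sum using (_⊎_)

-- A word of length n over {0,..,n-1} (0-based values; σ_i = toℕ (lookup σ i) + 1).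
-- All such words, by explicit enumeration.
allWords : (n k : ℕ) → List (Vec (Fin n) k)
allWords n zero    = [] ∷ []
allWords n (suc k) = concatMap (λ x → map (x ∷_) (allWords n k)) (allFin n)

allB : ∀ {A : Set} → (A → Bool) → List A → Bool
allB f []       = true
allB f (x ∷ xs) = f x ∧ allB f xs

-- a word of length n over Fin n is a permutation iff it is injective
isPerm : ∀ {n} → Vec (Fin n) n → Bool
isPerm {n} σ = allB (λ i → allB (λ j →
  ⌊ i Fin.≟ j ⌋ ∨ not ⌊ lookup σ i Fin.≟ lookup σ j ⌋) (allFin n)) (allFin n)

contains132 : ∀ {n} → Vec (Fin n) n → Bool
contains132 {n} σ = not (allB (λ i → allB (λ j → allB (λ k →
  not ( ⌊ i Fin.<? j ⌋ ∧ ⌊ j Fin.<? k ⌋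
      ∧ ⌊ lookup σ i Fin.<? lookup σ k ⌋ ∧ ⌊ lookup σ k Fin.<? lookup σ j ⌋ ))
  (allFin n)) (allFin n)) (allFin n))

T? : (b : Bool) → Dec (T b)
T? true  = yes _
T? false = no (λ ())

Av132 : (n : ℕ) → List (Vec (Fin n) n)
Av132 n = filter (λ σ → T? (isPerm σ ∧ not (contains132 σ))) (allWords n n)

data B (m : ℕ) : Set where
  fin : Fin m → B m
  ∞   : B m

data Tgt : Set where
  num : ℤ → Tgt
  inf : Tgt

_⊖_ : ∀ {m} → B m → ℕ → Tgt
fin i ⊖ k = num (+ toℕ i ℤ.- + k)
∞     ⊖ k = inf

-- does the element b of B_m equal the target t?  (false for negative t)
_≐_ : ∀ {m} → B m → Tgt → Bool
fin i ≐ num z = ⌊ + toℕ i ℤ.≟ z ⌋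
fin i ≐ inf   = false
∞     ≐ num z = false
∞     ≐ inf   = true

-- for σ ∈ Av_{n+1}(132) and k = n+2:  k - σ_1 ≤ p  (no condition if p = ∞)
headCond : ∀ {m} n → B m → Vec (Fin (suc n)) (suc n) → Bool
headCond n (fin i) σ = (suc (suc n) ∸ suc (toℕ (head σ))) ≤ᵇ toℕ i
headCond n ∞       σ = true

c : ∀ {m} → ℕ → B m → ℕ
c zero          p = 0   -- not used (k ranges over 1..m)
c (suc zero)    p = 1
c (suc (suc n)) p = length (filter (λ σ → T? (headCond n p σ)) (Av132 (suc n)))

Vtx : ℕ → Set
Vtx m = B m × B m

-- W_{(p,q),(r,s)}(x) = Σ_{k=1}^m c_{k,p} x^k χ[(r,s)=(m-k,q-k)] + x χ[(r,s)=(p-1,m-1)]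
coeffW : (m : ℕ) → Vtx m → Vtx m → ℕ → ℕ
coeffW m (p , q) (r , s) j =
  (if (1 ≤ᵇ j) ∧ (j ≤ᵇ m) ∧ (r ≐ num (+ m ℤ.- + j)) ∧ (s ≐ (q ⊖ j))
     then c j p else 0)
  + (if (j ≡ᵇ 1) ∧ (r ≐ (p ⊖ 1)) ∧ (s ≐ num (+ m ℤ.- + 1)) then 1 else 0)

record WEdge (m : ℕ) (C : Vtx m → Set) (u v : Vtx m) (j : ℕ) : Set where
  constructor wedge
  field
    srcIn : C u
    tgtIn : C v
    pos   : 0 < coeffW m v u j

data WWalk (m : ℕ) (C : Vtx m → Set) : Vtx m → Vtx m → ℕ → Set where
  nil  : ∀ {u} → WWalk m C u u 0
  cons : ∀ {u v w j t} → WEdge m C u v j → WWalk m C v w t → WWalk m C u w (j + t)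

ClosedWalkWeight : (m : ℕ) → (Vtx m → Set) → ℕ → Set
ClosedWalkWeight m C t =
  Σ (Vtx m) λ u → Σ (Vtx m) λ v → Σ ℕ λ j → Σ ℕ λ t' →
    WEdge m C u v j × WWalk m C v u t' × (t ≡ j + t')

-- weighted period = gcd of all closed-walk weights = 1,
-- i.e. the only common divisor of all closed-walk weights is 1
WeightedAperiodic : (m : ℕ) → (Vtx m → Set) → Set
WeightedAperiodic m C = ∀ d → (∀ t → ClosedWalkWeight m C t → d ∣ t) → d ≡ 1

data U (m : ℕ) : Vtx m → Set where
  u-mem : (p : Fin m) → U m (fin p , ∞)

data V (m : ℕ) : Vtx m → Set where
  v-below : (p q : Fin m) → toℕ q < toℕ p → V m (fin p , fin q)
  v-last  : (p q : Fin m) → toℕ p ≤ m ∸ 2 → toℕ q ≡ m ∸ 1 → V m (fin p , fin q)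

{-# OPTIONS --safe #-}
-- Every edge used below has weight 1 and comes from one of the two x-linear terms of W_m:
-- the k = 1 summand (source (m-1, q-1), target (p, q)) and the term x χ (source (p-1, m-1),
-- target (p, q)).  In U_m the first gives a loop of weight 1 at (m-1, ∞).  In V_m, with
-- t = m-1, they give the closed walks (t, t-1) → (t-1, t) → (t, t-1) of weight 2 and
-- (t, t-2) → (t, t-1) → (t-1, t) → (t, t-2) of weight 3, and gcd(2, 3) = 1.
module Submission where

open import Defs
open import Data.Bool using (Bool; true; _∧_; if_then_else_; T)
open import Data.Fin using (Fin; toℕ; fromℕ<)
open import Data.Fin.Properties using (toℕ-fromℕ<)
open import Data.Integer as ℤ using (ℤ; +_)
open import Data.Nat using (ℕ; suc; _+_; _≤_; _<_; s≤s; z≤n)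
open import Data.Nat.Coprimality using (Coprime; 1-coprimeTo; coprime-+)
open import Data.Nat.Properties using (≤-refl; ≤-reflexive; ≤-trans; m≤m+n; m≤n+m; m<n+m; n<1+n)
open import Data.Product using (_×_; _,_)
open import Relation.Binary.PropositionalEquality using (_≡_; refl; cong; trans; sym; subst₂)
open import Relation.Nullary.Decidable using (fromWitness)

aperiodic-if-coprime-weights : ∀ {m C s t} → Coprime s t →
  ClosedWalkWeight m C s → ClosedWalkWeight m C t → WeightedAperiodic m C
aperiodic-if-coprime-weights coprime ws wt d d∣weights =
  coprime (d∣weights _ ws , d∣weights _ wt)

closed-walk : ∀ {m C u v j t} →
  WEdge m C u v j → WWalk m C v u t → ClosedWalkWeight m C (j + t)
closed-walk e w = _ , _ , _ , _ , e , w , refl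

fin-≐ : ∀ {m} {i : Fin m} {z : ℤ} → + toℕ i ≡ z → T (fin i ≐ num z)
fin-≐ = fromWitness

fin-≐-pred : ∀ {m} {s q : Fin m} {i : ℕ} →
  toℕ s ≡ i → toℕ q ≡ suc i → T (fin s ≐ (fin q ⊖ 1))
fin-≐-pred s≡i q≡1+i = fin-≐ (trans (cong +_ s≡i) (cong (λ x → + x ℤ.- + 1) (sym q≡1+i)))

indicator-pos : ∀ {a b : Bool} → T a → T b → 0 < (if a ∧ b then 1 else 0)
indicator-pos {true} {true} _ _ = s≤s z≤n

module _ {k : ℕ} {C : Vtx (suc k) → Set} where

  edge-from-last-row : ∀ {p q s} {r : Fin (suc k)} → C (fin r , s) → C (p , q) →
    toℕ r ≡ k → T (s ≐ (q ⊖ 1)) → WEdge (suc k) C (fin r , s) (p , q) 1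
  edge-from-last-row u∈C v∈C r≡k s≐q-1 =
    wedge u∈C v∈C (≤-trans (indicator-pos (fin-≐ (cong +_ r≡k)) s≐q-1) (m≤m+n _ _))

  edge-from-last-column : ∀ {p q r} {s : Fin (suc k)} → C (r , fin s) → C (p , q) →
    T (r ≐ (p ⊖ 1)) → toℕ s ≡ k → WEdge (suc k) C (r , fin s) (p , q) 1
  edge-from-last-column u∈C v∈C r≐p-1 s≡k =
    wedge u∈C v∈C (≤-trans (indicator-pos r≐p-1 (fin-≐ (cong +_ s≡k))) (m≤n+m _ _))

U-aperiodic : ∀ k → WeightedAperiodic (suc k) (U (suc k))
U-aperiodic k = aperiodic-if-coprime-weights (1-coprimeTo 1) loop loop
  where
  last : Fin (suc k)
  last = fromℕ< (n<1+n k)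

  loop : ClosedWalkWeight (suc k) (U (suc k)) 1
  loop = closed-walk
    (edge-from-last-row (u-mem last) (u-mem last) (toℕ-fromℕ< (n<1+n k)) _) nil

module V-closed-walks (n : ℕ) where

  private
    t t-1 t-2 : Fin (3 + n)
    t   = fromℕ< (n<1+n (2 + n))
    t-1 = fromℕ< (m<n+m (1 + n) {2} (s≤s z≤n))
    t-2 = fromℕ< (m<n+m n {3} (s≤s z≤n))

    t≡ : toℕ t ≡ 2 + n
    t≡ = toℕ-fromℕ< (n<1+n (2 + n))

    t-1≡ : toℕ t-1 ≡ 1 + n
    t-1≡ = toℕ-fromℕ< (m<n+m (1 + n) {2} (s≤s z≤n))

    t-2≡ : toℕ t-2 ≡ n
    t-2≡ = toℕ-fromℕ< (m<n+m n {3} (s≤s z≤n))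

    ⟨t,t-1⟩ : V (3 + n) (fin t , fin t-1)
    ⟨t,t-1⟩ = v-below t t-1 (subst₂ _<_ (sym t-1≡) (sym t≡) ≤-refl)

    ⟨t-1,t⟩ : V (3 + n) (fin t-1 , fin t)
    ⟨t-1,t⟩ = v-last t-1 t (≤-reflexive t-1≡) t≡

    ⟨t,t-2⟩ : V (3 + n) (fin t , fin t-2)
    ⟨t,t-2⟩ = v-below t t-2 (subst₂ _<_ (sym t-2≡) (sym t≡) (m<n+m n {2} (s≤s z≤n)))

    swap-up : WEdge (3 + n) (V (3 + n)) (fin t , fin t-1) (fin t-1 , fin t) 1
    swap-up = edge-from-last-row ⟨t,t-1⟩ ⟨t-1,t⟩ t≡ (fin-≐-pred t-1≡ t≡)

    swap-down : ∀ {q} → V (3 + n) (fin t , q) →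
      WEdge (3 + n) (V (3 + n)) (fin t-1 , fin t) (fin t , q) 1
    swap-down v∈V = edge-from-last-column ⟨t-1,t⟩ v∈V (fin-≐-pred t-1≡ t≡) t≡

  weight-2 : ClosedWalkWeight (3 + n) (V (3 + n)) 2
  weight-2 = closed-walk swap-up (cons (swap-down ⟨t,t-1⟩) nil)

  weight-3 : ClosedWalkWeight (3 + n) (V (3 + n)) 3
  weight-3 = closed-walk
    (edge-from-last-row ⟨t,t-2⟩ ⟨t,t-1⟩ t≡ (fin-≐-pred t-2≡ t-1≡))
    (cons swap-up (cons (swap-down ⟨t,t-2⟩) nil))

V-aperiodic : ∀ n → WeightedAperiodic (3 + n) (V (3 + n))
V-aperiodic n =
  aperiodic-if-coprime-weights (coprime-+ (1-coprimeTo 2)) weight-3 weight-2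
  where open V-closed-walks n

lemma4p6 : (∀ m → 2 ≤ m → WeightedAperiodic m (U m))
         × (∀ m → 3 ≤ m → WeightedAperiodic m (V m))
lemma4p6 = (λ { (suc k) _ → U-aperiodic k })
         , (λ { _ (s≤s (s≤s (s≤s (z≤n {n})))) → V-aperiodic n })
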